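{- In the lattice of subvarieties of the variety $\mathsf{BKL}$ of bounded K-lattices, the variety $\mathbb{V}(\mathbf K_3)$ generated by $\mathbf K_3$ is the only atom.
   Context: A bounded commutative residuated lattice is an algebra $(A,\vee,\wedge,\cdot,\to,0,1)$ such that $(A,\vee,\wedge)$ is a lattice, $(A,\cdot,1)$ is a commutative monoid, $ab\le c$ iff $a\le b\to c$, $1$ is the greatest and $0$ the least element. For such $\mathbf A$, $K(\mathbf A)$ is the algebra on $A\times A$ with $(a,b)\vee(c,d)=(a\vee c,b\wedge d)$, $(a,b)\wedge(c,d)=(a\wedge c,b\vee d)$, $(a,b)(c,d)=(ac,(a\to d)\wedge(c\to b))$, $(a,b)\to(c,d)=((a\to c)\wedge(d\to b),ad)$, unit $(1,1)$ and constant $0$ interpreted as $(0,1)$. Write $\sim x:=x\to 1$. A K-lattice is a commutative residuated lattice $(A,\vee,\wedge,\cdot,\to,1)$ satisfying $\sim\sim x=x$, the lattice distributive laws whenever at least one of the three elements equals $1$, and the equations $xy\wedge 1=(x\wedge1)(y\wedge1)$ and $((x\wedge1)\to y)\wedge((\sim y\wedge 1)\to\sim x)=x\to y$. A bounded K-lattice is a K-lattice with an extra constant $0$ satisfying $0\le x$; $\mathsf{BKL}$ denotes their variety. Let $\mathbf 2$ be the two-element Boolean algebra $\{0,1\}$; $\mathbf K_3$ is the subalgebra of $K(\mathbf 2)$ with universe $\{(0,1),(1,1),(1,0)\}$. -}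

module Defs where

open import Data.Nat using (ℕ)
open import Data.Bool using (Bool; true; false; T) renaming (_∧_ to _∧ᵇ_; _∨_ to _∨ᵇ_; not to notᵇ)
open import Data.Unit using (tt)
open import Data.Product using (Σ; _×_; _,_; proj₁; proj₂)
open import Data.Sum using (_⊎_)
open import Relation.Binary.PropositionalEquality using (_≡_; _≢_)

infixr 5 _∨'_
infixr 6 _∧'_
infixr 7 _·'_
infixr 4 _⇒'_

data Term : Set where
  var   : ℕ → Term
  _∨'_  : Term → Term → Term
  _∧'_  : Term → Term → Term
  _·'_  : Term → Term → Term
  _⇒'_  : Term → Term → Term
  0'    : Term
  1'    : Term

record Algebra : Set₁ where
  field
    Carrier : Set
    _∨_ _∧_ _·_ _⇒_ : Carrier → Carrier → Carrier
    𝟘 𝟙 : Carrier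

module _ (A : Algebra) where
  open Algebra A

  eval : (ℕ → Carrier) → Term → Carrier
  eval ρ (var n) = ρ n
  eval ρ (s ∨' t) = eval ρ s ∨ eval ρ t
  eval ρ (s ∧' t) = eval ρ s ∧ eval ρ t
  eval ρ (s ·' t) = eval ρ s · eval ρ t
  eval ρ (s ⇒' t) = eval ρ s ⇒ eval ρ t
  eval ρ 0' = 𝟘
  eval ρ 1' = 𝟙

  _⊨_≈_ : Term → Term → Set
  _⊨_≈_ s t = ∀ (ρ : ℕ → Carrier) → eval ρ s ≡ eval ρ t

  _≤_ : Carrier → Carrier → Set
  a ≤ b = (a ∧ b) ≡ a

  ∼_ : Carrier → Carrier
  ∼ x = x ⇒ 𝟙

  record IsBKL : Set where
    field
      ∨-assoc : ∀ x y z → ((x ∨ y) ∨ z) ≡ (x ∨ (y ∨ z))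
      ∧-assoc : ∀ x y z → ((x ∧ y) ∧ z) ≡ (x ∧ (y ∧ z))
      ∨-comm  : ∀ x y → (x ∨ y) ≡ (y ∨ x)
      ∧-comm  : ∀ x y → (x ∧ y) ≡ (y ∧ x)
      ∨-absorbs-∧ : ∀ x y → (x ∨ (x ∧ y)) ≡ x
      ∧-absorbs-∨ : ∀ x y → (x ∧ (x ∨ y)) ≡ x
      ·-assoc : ∀ x y z → ((x · y) · z) ≡ (x · (y · z))
      ·-comm  : ∀ x y → (x · y) ≡ (y · x)
      ·-identity : ∀ x → (x · 𝟙) ≡ x
      residuated₁ : ∀ a b c → (a · b) ≤ c → a ≤ (b ⇒ c)
      residuated₂ : ∀ a b c → a ≤ (b ⇒ c) → (a · b) ≤ c
      involutive : ∀ x → (∼ (∼ x)) ≡ x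
      distrib-at-1 : ∀ x y z → (x ≡ 𝟙 ⊎ y ≡ 𝟙 ⊎ z ≡ 𝟙) →
                       ((x ∧ (y ∨ z)) ≡ ((x ∧ y) ∨ (x ∧ z)))
                     × ((x ∨ (y ∧ z)) ≡ ((x ∨ y) ∧ (x ∨ z)))
      ·-∧1 : ∀ x y → ((x · y) ∧ 𝟙) ≡ ((x ∧ 𝟙) · (y ∧ 𝟙))
      ⇒-split : ∀ x y → (((x ∧ 𝟙) ⇒ y) ∧ (((∼ y) ∧ 𝟙) ⇒ (∼ x))) ≡ (x ⇒ y)
      𝟘-least : ∀ x → 𝟘 ≤ x

-- Subvarieties of BKL, presented by a set of equations E
-- (a subvariety is BKL ∩ Mod(E), by Birkhoff's theorem)

Equations : Set₁
Equations = Term → Term → Set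

_∈V_ : Algebra → Equations → Set
A ∈V E = IsBKL A × (∀ s t → E s t → A ⊨ s ≈ t)

_⊑_ : Equations → Equations → Set₁
E ⊑ F = ∀ (A : Algebra) → A ∈V E → A ∈V F

_≋_ : Equations → Equations → Set₁
E ≋ F = (E ⊑ F) × (F ⊑ E)

NonTrivial : Equations → Set₁
NonTrivial E = Σ Algebra λ A → A ∈V E × Σ (Algebra.Carrier A) λ a →
                 Σ (Algebra.Carrier A) λ b → a ≢ b

IsAtom : Equations → Set₁
IsAtom E = NonTrivial E × (∀ F → F ⊑ E → NonTrivial F → E ⊑ F)

_→ᵇ_ : Bool → Bool → Bool
a →ᵇ b = notᵇ a ∨ᵇ b

K2 : Set
K2 = Bool × Bool

_∨K_ _∧K_ _·K_ _⇒K_ : K2 → K2 → K2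
(a , b) ∨K (c , d) = (a ∨ᵇ c , b ∧ᵇ d)
(a , b) ∧K (c , d) = (a ∧ᵇ c , b ∨ᵇ d)
(a , b) ·K (c , d) = (a ∧ᵇ c , (a →ᵇ d) ∧ᵇ (c →ᵇ b))
(a , b) ⇒K (c , d) = ((a →ᵇ c) ∧ᵇ (d →ᵇ b) , a ∧ᵇ d)

K⟨2⟩ : Algebra
K⟨2⟩ = record { Carrier = K2 ; _∨_ = _∨K_ ; _∧_ = _∧K_ ; _·_ = _·K_ ; _⇒_ = _⇒K_
              ; 𝟘 = (false , true) ; 𝟙 = (true , true) }

inK3 : K2 → Bool
inK3 (a , b) = a ∨ᵇ b

K3Carrier : Set
K3Carrier = Σ K2 λ p → T (inK3 p)

∨K-closed : ∀ p q → T (inK3 p) → T (inK3 q) → T (inK3 (p ∨K q))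
∨K-closed (false , false) (false , false) () _
∨K-closed (false , false) (false , true) () _
∨K-closed (false , false) (true , false) () _
∨K-closed (false , false) (true , true) () _
∨K-closed (false , true) (false , false) _ ()
∨K-closed (false , true) (false , true) _ _ = tt
∨K-closed (false , true) (true , false) _ _ = tt
∨K-closed (false , true) (true , true) _ _ = tt
∨K-closed (true , false) (false , false) _ ()
∨K-closed (true , false) (false , true) _ _ = tt
∨K-closed (true , false) (true , false) _ _ = tt
∨K-closed (true , false) (true , true) _ _ = tt
∨K-closed (true , true) (false , false) _ ()
∨K-closed (true , true) (false , true) _ _ = tt
∨K-closed (true , true) (true , false) _ _ = tt
∨K-closed (true , true) (true , true) _ _ = tt

∧K-closed : ∀ p q → T (inK3 p) → T (inK3 q) → T (inK3 (p ∧K q))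
∧K-closed (false , false) (false , false) () _
∧K-closed (false , false) (false , true) () _
∧K-closed (false , false) (true , false) () _
∧K-closed (false , false) (true , true) () _
∧K-closed (false , true) (false , false) _ ()
∧K-closed (false , true) (false , true) _ _ = tt
∧K-closed (false , true) (true , false) _ _ = tt
∧K-closed (false , true) (true , true) _ _ = tt
∧K-closed (true , false) (false , false) _ ()
∧K-closed (true , false) (false , true) _ _ = tt
∧K-closed (true , false) (true , false) _ _ = tt
∧K-closed (true , false) (true , true) _ _ = tt
∧K-closed (true , true) (false , false) _ ()
∧K-closed (true , true) (false , true) _ _ = tt
∧K-closed (true , true) (true , false) _ _ = tt
∧K-closed (true , true) (true , true) _ _ = tt

·K-closed : ∀ p q → T (inK3 p) → T (inK3 q) → T (inK3 (p ·K q))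
·K-closed (false , false) (false , false) () _
·K-closed (false , false) (false , true) () _
·K-closed (false , false) (true , false) () _
·K-closed (false , false) (true , true) () _
·K-closed (false , true) (false , false) _ ()
·K-closed (false , true) (false , true) _ _ = tt
·K-closed (false , true) (true , false) _ _ = tt
·K-closed (false , true) (true , true) _ _ = tt
·K-closed (true , false) (false , false) _ ()
·K-closed (true , false) (false , true) _ _ = tt
·K-closed (true , false) (true , false) _ _ = tt
·K-closed (true , false) (true , true) _ _ = tt
·K-closed (true , true) (false , false) _ ()
·K-closed (true , true) (false , true) _ _ = tt
·K-closed (true , true) (true , false) _ _ = tt
·K-closed (true , true) (true , true) _ _ = tt

⇒K-closed : ∀ p q → T (inK3 p) → T (inK3 q) → T (inK3 (p ⇒K q))
⇒K-closed (false , false) (false , false) () _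
⇒K-closed (false , false) (false , true) () _
⇒K-closed (false , false) (true , false) () _
⇒K-closed (false , false) (true , true) () _
⇒K-closed (false , true) (false , false) _ ()
⇒K-closed (false , true) (false , true) _ _ = tt
⇒K-closed (false , true) (true , false) _ _ = tt
⇒K-closed (false , true) (true , true) _ _ = tt
⇒K-closed (true , false) (false , false) _ ()
⇒K-closed (true , false) (false , true) _ _ = tt
⇒K-closed (true , false) (true , false) _ _ = tt
⇒K-closed (true , false) (true , true) _ _ = tt
⇒K-closed (true , true) (false , false) _ ()
⇒K-closed (true , true) (false , true) _ _ = tt
⇒K-closed (true , true) (true , false) _ _ = tt
⇒K-closed (true , true) (true , true) _ _ = tt

K3 : Algebra
K3 = record
  { Carrier = K3Carrier
  ; _∨_ = λ p q → (proj₁ p ∨K proj₁ q , ∨K-closed (proj₁ p) (proj₁ q) (proj₂ p) (proj₂ q))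
  ; _∧_ = λ p q → (proj₁ p ∧K proj₁ q , ∧K-closed (proj₁ p) (proj₁ q) (proj₂ p) (proj₂ q))
  ; _·_ = λ p q → (proj₁ p ·K proj₁ q , ·K-closed (proj₁ p) (proj₁ q) (proj₂ p) (proj₂ q))
  ; _⇒_ = λ p q → (proj₁ p ⇒K proj₁ q , ⇒K-closed (proj₁ p) (proj₁ q) (proj₂ p) (proj₂ q))
  ; 𝟘 = ((false , true) , tt)
  ; 𝟙 = ((true , true) , tt)
  }

Eq[K3] : Equations
Eq[K3] s t = K3 ⊨ s ≈ t

-- In a bounded K-lattice ⊤ = ∼𝟘 = 𝟘 ⇒ 𝟙 is the greatest element, and residuation alone
-- determines the operations on {𝟘, 𝟙, ⊤}: 𝟘 is absorbing for ·, 𝟙 is neutral for · and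
-- on the left of ⇒, 𝟘 ⇒ x = ⊤, ⊤ · ⊤ = ⊤ ⇒ ⊤ = ⊤ and ⊤ ⇒ 𝟘 = ⊤ ⇒ 𝟙 = ∼∼𝟘 = 𝟘. In a
-- nontrivial algebra these three elements are distinct, so they form a copy of K3.
-- Hence K3 satisfies every equation of every nontrivial subvariety, i.e. V(K3) lies
-- below each of them; this makes it an atom, and forces every atom to equal it.

module Submission where

open import Defs hiding (_≤_)
open import Data.Bool using (false; true)
import Data.Bool.Properties as Bool
open import Data.Empty using (⊥-elim)
open import Data.Product using (_×_; _,_; proj₂)
open import Data.Product.Properties using (≡-dec)
open import Data.Sum using (_⊎_; inj₁; inj₂; [_,_])
open import Data.Unit using (tt)
open import Function using (_∘_; id)
open import Function.Definitions using (Injective)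
open import Relation.Binary.Bundles using (Poset)
open import Relation.Binary.Definitions using (DecidableEquality)
open import Relation.Binary.PropositionalEquality
  using (_≡_; _≢_; refl; sym; trans; cong; cong₂; isEquivalence; module ≡-Reasoning)
open import Relation.Nullary.Decidable using (Dec; yes; map′; from-yes; _×-dec_; _→-dec_)
open import Relation.Unary using (Pred; Decidable)

module _ (A B : Algebra) where
  private
    module A = Algebra A
    module B = Algebra B

  record IsHomomorphism (h : A.Carrier → B.Carrier) : Set where
    field
      ∨-homo : ∀ x y → h (x A.∨ y) ≡ h x B.∨ h y
      ∧-homo : ∀ x y → h (x A.∧ y) ≡ h x B.∧ h y
      ·-homo : ∀ x y → h (x A.· y) ≡ h x B.· h y
      ⇒-homo : ∀ x y → h (x A.⇒ y) ≡ h x B.⇒ h y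
      𝟘-homo : h A.𝟘 ≡ B.𝟘
      𝟙-homo : h A.𝟙 ≡ B.𝟙

  module _ {h : A.Carrier → B.Carrier} (hom : IsHomomorphism h) where
    open IsHomomorphism hom

    eval-homo : ∀ ρ s → h (eval A ρ s) ≡ eval B (h ∘ ρ) s
    eval-homo ρ (var n) = refl
    eval-homo ρ (s ∨' t) = trans (∨-homo _ _) (cong₂ B._∨_ (eval-homo ρ s) (eval-homo ρ t))
    eval-homo ρ (s ∧' t) = trans (∧-homo _ _) (cong₂ B._∧_ (eval-homo ρ s) (eval-homo ρ t))
    eval-homo ρ (s ·' t) = trans (·-homo _ _) (cong₂ B._·_ (eval-homo ρ s) (eval-homo ρ t))
    eval-homo ρ (s ⇒' t) = trans (⇒-homo _ _) (cong₂ B._⇒_ (eval-homo ρ s) (eval-homo ρ t))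
    eval-homo ρ 0' = 𝟘-homo
    eval-homo ρ 1' = 𝟙-homo

    injective-homo-reflects-⊨ : Injective _≡_ _≡_ h → ∀ s t → B ⊨ s ≈ t → A ⊨ s ≈ t
    injective-homo-reflects-⊨ inj s t B⊨s≈t ρ = inj (begin
      h (eval A ρ s)   ≡⟨ eval-homo ρ s ⟩
      eval B (h ∘ ρ) s ≡⟨ B⊨s≈t (h ∘ ρ) ⟩
      eval B (h ∘ ρ) t ≡⟨ eval-homo ρ t ⟨
      h (eval A ρ t)   ∎)
      where open ≡-Reasoning

module BKLProperties {B : Algebra} (isBKL : IsBKL B) where
  open Algebra B
  open IsBKL isBKL

  infix 4 _≤_
  _≤_ : Carrier → Carrier → Set
  _≤_ = Defs._≤_ B

  ≤-refl : ∀ {x} → x ≤ x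
  ≤-refl {x} = begin
    x ∧ x              ≡⟨ cong (x ∧_) (∨-absorbs-∧ x x) ⟨
    x ∧ (x ∨ (x ∧ x))  ≡⟨ ∧-absorbs-∨ x (x ∧ x) ⟩
    x                  ∎
    where open ≡-Reasoning

  ≤-reflexive : ∀ {x y} → x ≡ y → x ≤ y
  ≤-reflexive refl = ≤-refl

  ≤-trans : ∀ {x y z} → x ≤ y → y ≤ z → x ≤ z
  ≤-trans {x} {y} {z} x≤y y≤z = begin
    x ∧ z        ≡⟨ cong (_∧ z) x≤y ⟨
    (x ∧ y) ∧ z  ≡⟨ ∧-assoc x y z ⟩
    x ∧ (y ∧ z)  ≡⟨ cong (x ∧_) y≤z ⟩
    x ∧ y        ≡⟨ x≤y ⟩
    x            ∎
    where open ≡-Reasoning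

  ≤-antisym : ∀ {x y} → x ≤ y → y ≤ x → x ≡ y
  ≤-antisym {x} {y} x≤y y≤x = trans (sym x≤y) (trans (∧-comm x y) y≤x)

  ≤-poset : Poset _ _ _
  ≤-poset = record
    { isPartialOrder = record
      { isPreorder = record { isEquivalence = isEquivalence ; reflexive = ≤-reflexive ; trans = ≤-trans }
      ; antisym = ≤-antisym
      }
    }

  open import Relation.Binary.Reasoning.PartialOrder ≤-poset

  x≤y⇒y∧x≡x : ∀ {x y} → x ≤ y → y ∧ x ≡ x
  x≤y⇒y∧x≡x {x} {y} x≤y = trans (∧-comm y x) x≤y

  x≤y⇒y∨x≡y : ∀ {x y} → x ≤ y → y ∨ x ≡ y
  x≤y⇒y∨x≡y {x} {y} x≤y = trans (cong (y ∨_) (sym (x≤y⇒y∧x≡x x≤y))) (∨-absorbs-∧ y x)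

  x≤y⇒x∨y≡y : ∀ {x y} → x ≤ y → x ∨ y ≡ y
  x≤y⇒x∨y≡y {x} {y} x≤y = trans (∨-comm x y) (x≤y⇒y∨x≡y x≤y)

  ·-identityˡ : ∀ x → 𝟙 · x ≡ x
  ·-identityˡ x = trans (·-comm 𝟙 x) (·-identity x)

  ⇒-eval : ∀ x y → (x ⇒ y) · x ≤ y
  ⇒-eval x y = residuated₂ (x ⇒ y) x y ≤-refl

  ·-monoʳ-≤ : ∀ z {x y} → x ≤ y → z · x ≤ z · y
  ·-monoʳ-≤ z {x} {y} x≤y = begin
    z · x  ≡⟨ ·-comm z x ⟩
    x · z  ≤⟨ residuated₂ x z (z · y) (≤-trans x≤y (residuated₁ y z (z · y) (≤-reflexive (·-comm y z)))) ⟩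
    z · y  ∎

  ⇒-monoʳ-≤ : ∀ z {x y} → x ≤ y → z ⇒ x ≤ z ⇒ y
  ⇒-monoʳ-≤ z {x} {y} x≤y = residuated₁ (z ⇒ x) z y (≤-trans (⇒-eval z x) x≤y)

  ⇒-identityˡ : ∀ x → 𝟙 ⇒ x ≡ x
  ⇒-identityˡ x = ≤-antisym
    (begin
      𝟙 ⇒ x        ≡⟨ ·-identity (𝟙 ⇒ x) ⟨
      (𝟙 ⇒ x) · 𝟙  ≤⟨ ⇒-eval 𝟙 x ⟩
      x            ∎)
    (residuated₁ x 𝟙 x (≤-reflexive (·-identity x)))

  ·-zeroˡ : ∀ x → 𝟘 · x ≡ 𝟘
  ·-zeroˡ x = ≤-antisym (residuated₂ 𝟘 x 𝟘 (𝟘-least (x ⇒ 𝟘))) (𝟘-least (𝟘 · x))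

  ·-zeroʳ : ∀ x → x · 𝟘 ≡ 𝟘
  ·-zeroʳ x = trans (·-comm x 𝟘) (·-zeroˡ x)

  ⊤ : Carrier
  ⊤ = 𝟘 ⇒ 𝟙

  𝟘⇒-greatest : ∀ x y → y ≤ 𝟘 ⇒ x
  𝟘⇒-greatest x y = residuated₁ y 𝟘 x (begin
    y · 𝟘  ≡⟨ ·-zeroʳ y ⟩
    𝟘      ≤⟨ 𝟘-least x ⟩
    x      ∎)

  ⊤-greatest : ∀ x → x ≤ ⊤
  ⊤-greatest = 𝟘⇒-greatest 𝟙

  𝟘⇒x≡⊤ : ∀ x → 𝟘 ⇒ x ≡ ⊤
  𝟘⇒x≡⊤ x = ≤-antisym (⊤-greatest (𝟘 ⇒ x)) (𝟘⇒-greatest x ⊤)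

  ⊤·⊤≡⊤ : ⊤ · ⊤ ≡ ⊤
  ⊤·⊤≡⊤ = ≤-antisym (⊤-greatest (⊤ · ⊤)) (begin
    ⊤      ≡⟨ ·-identity ⊤ ⟨
    ⊤ · 𝟙  ≤⟨ ·-monoʳ-≤ ⊤ (⊤-greatest 𝟙) ⟩
    ⊤ · ⊤  ∎)

  ⊤⇒⊤≡⊤ : ⊤ ⇒ ⊤ ≡ ⊤
  ⊤⇒⊤≡⊤ = ≤-antisym (⊤-greatest (⊤ ⇒ ⊤)) (residuated₁ ⊤ ⊤ ⊤ (⊤-greatest (⊤ · ⊤)))

  ⊤⇒𝟙≡𝟘 : ⊤ ⇒ 𝟙 ≡ 𝟘
  ⊤⇒𝟙≡𝟘 = involutive 𝟘

  ⊤⇒𝟘≡𝟘 : ⊤ ⇒ 𝟘 ≡ 𝟘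
  ⊤⇒𝟘≡𝟘 = ≤-antisym
    (begin
      ⊤ ⇒ 𝟘  ≤⟨ ⇒-monoʳ-≤ ⊤ (𝟘-least 𝟙) ⟩
      ⊤ ⇒ 𝟙  ≡⟨ ⊤⇒𝟙≡𝟘 ⟩
      𝟘      ∎)
    (𝟘-least (⊤ ⇒ 𝟘))

  𝟘≡𝟙⇒trivial : 𝟘 ≡ 𝟙 → ∀ x → x ≡ 𝟘
  𝟘≡𝟙⇒trivial 𝟘≡𝟙 x = ≤-antisym (begin
    x      ≤⟨ ⊤-greatest x ⟩
    𝟘 ⇒ 𝟙  ≡⟨ cong (_⇒ 𝟙) 𝟘≡𝟙 ⟩
    𝟙 ⇒ 𝟙  ≡⟨ ⇒-identityˡ 𝟙 ⟩
    𝟙      ≡⟨ 𝟘≡𝟙 ⟨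
    𝟘      ∎) (𝟘-least x)

  x≢y⇒𝟘≢𝟙 : ∀ {x y} → x ≢ y → 𝟘 ≢ 𝟙
  x≢y⇒𝟘≢𝟙 {x} {y} x≢y 𝟘≡𝟙 = x≢y (trans (𝟘≡𝟙⇒trivial 𝟘≡𝟙 x) (sym (𝟘≡𝟙⇒trivial 𝟘≡𝟙 y)))

  module _ (𝟘≢𝟙 : 𝟘 ≢ 𝟙) where
    ⊤≢𝟘 : ⊤ ≢ 𝟘
    ⊤≢𝟘 ⊤≡𝟘 = 𝟘≢𝟙 (sym (≤-antisym (≤-trans (⊤-greatest 𝟙) (≤-reflexive ⊤≡𝟘)) (𝟘-least 𝟙)))

    𝟙≢⊤ : 𝟙 ≢ ⊤
    𝟙≢⊤ 𝟙≡⊤ = 𝟘≢𝟙 (begin-equality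
      𝟘      ≡⟨ ⊤⇒𝟙≡𝟘 ⟨
      ⊤ ⇒ 𝟙  ≡⟨ cong (_⇒ 𝟙) 𝟙≡⊤ ⟨
      𝟙 ⇒ 𝟙  ≡⟨ ⇒-identityˡ 𝟙 ⟩
      𝟙      ∎)

private
  variable
    A : Algebra
    E F G : Equations

infixr 6 _∪_
_∪_ : Equations → Equations → Equations
(E ∪ F) s t = E s t ⊎ F s t

⊑-trans : E ⊑ F → F ⊑ G → E ⊑ G
⊑-trans E⊑F F⊑G A A∈E = F⊑G A (E⊑F A A∈E)

∪-⊑ˡ : (E ∪ F) ⊑ E
∪-⊑ˡ A (isBKL , A⊨E∪F) = isBKL , λ s t → A⊨E∪F s t ∘ inj₁

∪-⊑ʳ : (E ∪ F) ⊑ F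
∪-⊑ʳ A (isBKL , A⊨E∪F) = isBKL , λ s t → A⊨E∪F s t ∘ inj₂

∈V-∪ : A ∈V E → A ∈V F → A ∈V (E ∪ F)
∈V-∪ (isBKL , A⊨E) (_ , A⊨F) = isBKL , λ s t → [ A⊨E s t , A⊨F s t ]

pattern 0₃ = ((false , true) , tt)
pattern 1₃ = ((true , true) , tt)
pattern ⊤₃ = ((true , false) , tt)

infix 4 _≟₃_
_≟₃_ : DecidableEquality K3Carrier
_≟₃_ = ≡-dec (≡-dec Bool._≟_ Bool._≟_) λ p q → yes (Bool.T-irrelevant p q)

∀₃? : ∀ {ℓ} {P : Pred K3Carrier ℓ} → Decidable P → Dec (∀ x → P x)
∀₃? P? = map′ (λ (p₀ , p₁ , p⊤) → λ { 0₃ → p₀ ; 1₃ → p₁ ; ⊤₃ → p⊤ ; ((false , false) , ()) })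
              (λ ∀P → ∀P 0₃ , ∀P 1₃ , ∀P ⊤₃)
              (P? 0₃ ×-dec P? 1₃ ×-dec P? ⊤₃)

K3-isBKL : IsBKL K3
K3-isBKL = record
  { ∨-assoc = from-yes (∀₃? λ x → ∀₃? λ y → ∀₃? λ z → (x ∨ y) ∨ z ≟₃ x ∨ (y ∨ z))
  ; ∧-assoc = from-yes (∀₃? λ x → ∀₃? λ y → ∀₃? λ z → (x ∧ y) ∧ z ≟₃ x ∧ (y ∧ z))
  ; ∨-comm = from-yes (∀₃? λ x → ∀₃? λ y → x ∨ y ≟₃ y ∨ x)
  ; ∧-comm = from-yes (∀₃? λ x → ∀₃? λ y → x ∧ y ≟₃ y ∧ x)
  ; ∨-absorbs-∧ = from-yes (∀₃? λ x → ∀₃? λ y → x ∨ (x ∧ y) ≟₃ x)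
  ; ∧-absorbs-∨ = from-yes (∀₃? λ x → ∀₃? λ y → x ∧ (x ∨ y) ≟₃ x)
  ; ·-assoc = from-yes (∀₃? λ x → ∀₃? λ y → ∀₃? λ z → (x · y) · z ≟₃ x · (y · z))
  ; ·-comm = from-yes (∀₃? λ x → ∀₃? λ y → x · y ≟₃ y · x)
  ; ·-identity = from-yes (∀₃? λ x → x · 𝟙 ≟₃ x)
  ; residuated₁ = from-yes (∀₃? λ a → ∀₃? λ b → ∀₃? λ c →
                    ((a · b) ∧ c ≟₃ a · b) →-dec (a ∧ (b ⇒ c) ≟₃ a))
  ; residuated₂ = from-yes (∀₃? λ a → ∀₃? λ b → ∀₃? λ c →
                    (a ∧ (b ⇒ c) ≟₃ a) →-dec ((a · b) ∧ c ≟₃ a · b))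
  ; involutive = from-yes (∀₃? λ x → (x ⇒ 𝟙) ⇒ 𝟙 ≟₃ x)
  ; distrib-at-1 = λ x y z _ → distributive x y z
  ; ·-∧1 = from-yes (∀₃? λ x → ∀₃? λ y → (x · y) ∧ 𝟙 ≟₃ (x ∧ 𝟙) · (y ∧ 𝟙))
  ; ⇒-split = from-yes (∀₃? λ x → ∀₃? λ y → ((x ∧ 𝟙) ⇒ y) ∧ (((y ⇒ 𝟙) ∧ 𝟙) ⇒ (x ⇒ 𝟙)) ≟₃ x ⇒ y)
  ; 𝟘-least = from-yes (∀₃? λ x → 𝟘 ∧ x ≟₃ 𝟘)
  }
  where
  open Algebra K3

  -- K3 is a chain, so distributivity holds without the side condition.
  distributive : ∀ x y z → (x ∧ (y ∨ z) ≡ (x ∧ y) ∨ (x ∧ z)) × (x ∨ (y ∧ z) ≡ (x ∨ y) ∧ (x ∨ z))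
  distributive = from-yes (∀₃? λ x → ∀₃? λ y → ∀₃? λ z →
    (x ∧ (y ∨ z) ≟₃ (x ∧ y) ∨ (x ∧ z)) ×-dec (x ∨ (y ∧ z) ≟₃ (x ∨ y) ∧ (x ∨ z)))

module K3Embedding {B : Algebra} (isBKL : IsBKL B) (𝟘≢𝟙 : Algebra.𝟘 B ≢ Algebra.𝟙 B) where
  open Algebra B
  open IsBKL isBKL
  open BKLProperties isBKL
  private module K = Algebra K3

  ι : K3Carrier → Carrier
  ι 0₃ = 𝟘
  ι 1₃ = 𝟙
  ι ⊤₃ = ⊤
  ι ((false , false) , ())

  ι-injective : Injective _≡_ _≡_ ι
  ι-injective {0₃} {0₃} _ = refl
  ι-injective {1₃} {1₃} _ = refl
  ι-injective {⊤₃} {⊤₃} _ = refl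
  ι-injective {0₃} {1₃} 𝟘≡𝟙 = ⊥-elim (𝟘≢𝟙 𝟘≡𝟙)
  ι-injective {1₃} {0₃} 𝟙≡𝟘 = ⊥-elim (𝟘≢𝟙 (sym 𝟙≡𝟘))
  ι-injective {0₃} {⊤₃} 𝟘≡⊤ = ⊥-elim (⊤≢𝟘 𝟘≢𝟙 (sym 𝟘≡⊤))
  ι-injective {⊤₃} {0₃} ⊤≡𝟘 = ⊥-elim (⊤≢𝟘 𝟘≢𝟙 ⊤≡𝟘)
  ι-injective {1₃} {⊤₃} 𝟙≡⊤ = ⊥-elim (𝟙≢⊤ 𝟘≢𝟙 𝟙≡⊤)
  ι-injective {⊤₃} {1₃} ⊤≡𝟙 = ⊥-elim (𝟙≢⊤ 𝟘≢𝟙 (sym ⊤≡𝟙))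
  ι-injective {(false , false) , ()}
  ι-injective {_} {(false , false) , ()}

  𝟘≤𝟙 : 𝟘 ≤ 𝟙
  𝟘≤𝟙 = 𝟘-least 𝟙

  𝟘≤⊤ : 𝟘 ≤ ⊤
  𝟘≤⊤ = 𝟘-least ⊤

  𝟙≤⊤ : 𝟙 ≤ ⊤
  𝟙≤⊤ = ⊤-greatest 𝟙

  ι-∨-homo : ∀ x y → ι (x K.∨ y) ≡ ι x ∨ ι y
  ι-∨-homo 0₃ 0₃ = sym (x≤y⇒x∨y≡y ≤-refl)
  ι-∨-homo 0₃ 1₃ = sym (x≤y⇒x∨y≡y 𝟘≤𝟙)
  ι-∨-homo 0₃ ⊤₃ = sym (x≤y⇒x∨y≡y 𝟘≤⊤)
  ι-∨-homo 1₃ 0₃ = sym (x≤y⇒y∨x≡y 𝟘≤𝟙)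
  ι-∨-homo 1₃ 1₃ = sym (x≤y⇒x∨y≡y ≤-refl)
  ι-∨-homo 1₃ ⊤₃ = sym (x≤y⇒x∨y≡y 𝟙≤⊤)
  ι-∨-homo ⊤₃ 0₃ = sym (x≤y⇒y∨x≡y 𝟘≤⊤)
  ι-∨-homo ⊤₃ 1₃ = sym (x≤y⇒y∨x≡y 𝟙≤⊤)
  ι-∨-homo ⊤₃ ⊤₃ = sym (x≤y⇒x∨y≡y ≤-refl)
  ι-∨-homo ((false , false) , ()) _
  ι-∨-homo _ ((false , false) , ())

  ι-∧-homo : ∀ x y → ι (x K.∧ y) ≡ ι x ∧ ι y
  ι-∧-homo 0₃ 0₃ = sym ≤-refl
  ι-∧-homo 0₃ 1₃ = sym 𝟘≤𝟙
  ι-∧-homo 0₃ ⊤₃ = sym 𝟘≤⊤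
  ι-∧-homo 1₃ 0₃ = sym (x≤y⇒y∧x≡x 𝟘≤𝟙)
  ι-∧-homo 1₃ 1₃ = sym ≤-refl
  ι-∧-homo 1₃ ⊤₃ = sym 𝟙≤⊤
  ι-∧-homo ⊤₃ 0₃ = sym (x≤y⇒y∧x≡x 𝟘≤⊤)
  ι-∧-homo ⊤₃ 1₃ = sym (x≤y⇒y∧x≡x 𝟙≤⊤)
  ι-∧-homo ⊤₃ ⊤₃ = sym ≤-refl
  ι-∧-homo ((false , false) , ()) _
  ι-∧-homo _ ((false , false) , ())

  ι-·-homo : ∀ x y → ι (x K.· y) ≡ ι x · ι y
  ι-·-homo 0₃ 0₃ = sym (·-zeroˡ 𝟘)
  ι-·-homo 0₃ 1₃ = sym (·-zeroˡ 𝟙)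
  ι-·-homo 0₃ ⊤₃ = sym (·-zeroˡ ⊤)
  ι-·-homo 1₃ 0₃ = sym (·-identityˡ 𝟘)
  ι-·-homo 1₃ 1₃ = sym (·-identityˡ 𝟙)
  ι-·-homo 1₃ ⊤₃ = sym (·-identityˡ ⊤)
  ι-·-homo ⊤₃ 0₃ = sym (·-zeroʳ ⊤)
  ι-·-homo ⊤₃ 1₃ = sym (·-identity ⊤)
  ι-·-homo ⊤₃ ⊤₃ = sym ⊤·⊤≡⊤
  ι-·-homo ((false , false) , ()) _
  ι-·-homo _ ((false , false) , ())

  ι-⇒-homo : ∀ x y → ι (x K.⇒ y) ≡ ι x ⇒ ι y
  ι-⇒-homo 0₃ 0₃ = sym (𝟘⇒x≡⊤ 𝟘)
  ι-⇒-homo 0₃ 1₃ = sym (𝟘⇒x≡⊤ 𝟙)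
  ι-⇒-homo 0₃ ⊤₃ = sym (𝟘⇒x≡⊤ ⊤)
  ι-⇒-homo 1₃ 0₃ = sym (⇒-identityˡ 𝟘)
  ι-⇒-homo 1₃ 1₃ = sym (⇒-identityˡ 𝟙)
  ι-⇒-homo 1₃ ⊤₃ = sym (⇒-identityˡ ⊤)
  ι-⇒-homo ⊤₃ 0₃ = sym ⊤⇒𝟘≡𝟘
  ι-⇒-homo ⊤₃ 1₃ = sym ⊤⇒𝟙≡𝟘
  ι-⇒-homo ⊤₃ ⊤₃ = sym ⊤⇒⊤≡⊤
  ι-⇒-homo ((false , false) , ()) _
  ι-⇒-homo _ ((false , false) , ())

  ι-isHomomorphism : IsHomomorphism K3 B ι
  ι-isHomomorphism = record
    { ∨-homo = ι-∨-homo ; ∧-homo = ι-∧-homo ; ·-homo = ι-·-homo ; ⇒-homo = ι-⇒-homo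
    ; 𝟘-homo = refl ; 𝟙-homo = refl }

nontrivial-BKL⇒K3⊨ : ∀ {B} → IsBKL B → {x y : Algebra.Carrier B} → x ≢ y →
                      ∀ s t → B ⊨ s ≈ t → K3 ⊨ s ≈ t
nontrivial-BKL⇒K3⊨ isBKL x≢y = injective-homo-reflects-⊨ K3 _ ι-isHomomorphism ι-injective
  where open K3Embedding isBKL (BKLProperties.x≢y⇒𝟘≢𝟙 isBKL x≢y)

K3∈V[K3] : K3 ∈V Eq[K3]
K3∈V[K3] = K3-isBKL , λ s t → id

K3∈V⇒nonTrivial : K3 ∈V E → NonTrivial E
K3∈V⇒nonTrivial K3∈E = K3 , K3∈E , 0₃ , 1₃ , λ ()

nonTrivial⇒K3∈V : NonTrivial E → K3 ∈V E
nonTrivial⇒K3∈V (B , (isBKL , B⊨E) , x , y , x≢y) =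
  K3-isBKL , λ s t → nontrivial-BKL⇒K3⊨ isBKL x≢y s t ∘ B⊨E s t

nonTrivial⇒Eq[K3]⊑ : NonTrivial E → Eq[K3] ⊑ E
nonTrivial⇒Eq[K3]⊑ E-nonTrivial A (isBKL , A⊨K3) =
  isBKL , λ s t → A⊨K3 s t ∘ proj₂ (nonTrivial⇒K3∈V E-nonTrivial) s t

theorem2p1 : IsAtom Eq[K3] × (∀ (E : Equations) → IsAtom E → E ≋ Eq[K3])
theorem2p1 = (K3∈V⇒nonTrivial K3∈V[K3] , λ _ _ → nonTrivial⇒Eq[K3]⊑) , atom≋Eq[K3]
  where
  atom≋Eq[K3] : ∀ E → IsAtom E → E ≋ Eq[K3]
  atom≋Eq[K3] E (E-nonTrivial , E-minimal) =
      ⊑-trans (E-minimal (E ∪ Eq[K3]) ∪-⊑ˡ E∪Eq[K3]-nonTrivial) ∪-⊑ʳ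
    , nonTrivial⇒Eq[K3]⊑ E-nonTrivial
    where
    E∪Eq[K3]-nonTrivial : NonTrivial (E ∪ Eq[K3])
    E∪Eq[K3]-nonTrivial = K3∈V⇒nonTrivial (∈V-∪ (nonTrivial⇒K3∈V E-nonTrivial) K3∈V[K3])
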